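{- Let $G_1, G_2$ be two graphs on the same vertex set $V$. Let $A \subseteq S(G_1) \cap S(G_2)$ and $B\subseteq V$ be such that $N_{G_1}(B) \cup N_{G_2}(B) \subseteq A$. Suppose that $E(G_1) \triangle E(G_2) \subseteq \binom{A \cup B}{2}$. Then \[ S(G_1) \setminus B = S(G_2)\setminus B,\quad P(G_1) \setminus B = P(G_2) \setminus B,\quad R(G_1) \setminus B = R(G_2) \setminus B. \] Moreover, for every vertex $w \in V \setminus B$ we have $C_w(G_1) = C_w(G_2) \subseteq V \setminus (A \cup B)$, and hence $G_1[C_w(G_1)] = G_2[C_w(G_2)]$ and $R(G_1) \cap C_w(G_1) = R(G_2) \cap C_w(G_2)$.
   Context: All graphs are finite and simple; $\triangle$ denotes symmetric difference. For a graph $G$ and $X \subseteq V(G)$, $N_G(X) \coloneqq \{y \in V(G)\setminus X \colon y \text{ has a neighbour in } X\}$ and $N_G(x) \coloneqq N_G(\{x\})$. A set $X \subseteq V(G)$ has the strong $4$-core property for $G$ if $|N_G(x) \cap X| \geq 4$ for every $x \in X \cup N_G(X)$; the strong $4$-core $S(G)$ is the largest set with this property (the union of all such sets); $P(G) \coloneqq N_G(S(G))$ and $R(G) \coloneqq V(G) \setminus (S(G)\cup P(G))$. For $w \in V(G)$, $C_w(G)$ is the connected component of $G[P(G)\cup R(G)]$ containing $w$ if $w \in P(G)\cup R(G)$, and $C_w(G) \coloneqq \varnothing$ if $w \in S(G)$. -}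

module Defs where

open import Data.Nat using (ℕ; _≤_)
open import Data.Bool using (Bool; true; false)
open import Data.Fin using (Fin)
open import Data.Fin.Subset using (Subset; _∈_; _∉_; _∩_; ∣_∣)
open import Data.Vec using (tabulate)
open import Data.Product using (Σ; ∃; ∃-syntax; _×_)
open import Data.Sum using (_⊎_)
open import Relation.Nullary using (¬_)
open import Relation.Binary.PropositionalEquality using (_≡_)

record Graph (n : ℕ) : Set where
  field
    adj    : Fin n → Fin n → Bool
    sym    : ∀ x y → adj x y ≡ adj y x
    irrefl : ∀ x → adj x x ≡ false
open Graph public

module _ {n : ℕ} (G : Graph n) where

  Edge : Fin n → Fin n → Set
  Edge x y = adj G x y ≡ true

  Nbhd : Fin n → Subset n
  Nbhd x = tabulate (adj G x)

  InNbhdOf : (Fin n → Set) → Fin n → Set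
  InNbhdOf X y = ¬ X y × ∃[ x ] (X x × Edge x y)

  Strong4Core : Subset n → Set
  Strong4Core X = ∀ x → (x ∈ X ⊎ InNbhdOf (_∈ X) x) → 4 ≤ ∣ Nbhd x ∩ X ∣

  InS : Fin n → Set
  InS v = ∃[ X ] (Strong4Core X × v ∈ X)

  InP : Fin n → Set
  InP = InNbhdOf InS

  InR : Fin n → Set
  InR v = ¬ InS v × ¬ InP v

  data WalkOutsideS : Fin n → Fin n → Set where
    here : ∀ {w} → ¬ InS w → WalkOutsideS w w
    step : ∀ {w u v} → ¬ InS w → Edge w u → WalkOutsideS u v → WalkOutsideS w v

  -- v ∈ C_w(G): v lies in the component of G[P(G) ∪ R(G)] containing w
  -- (empty if w ∈ S(G))
  InC : Fin n → Fin n → Set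
  InC w v = WalkOutsideS w v

_≐_ : ∀ {n} → (Fin n → Set) → (Fin n → Set) → Set
_≐_ {n} X Y = ∀ (v : Fin n) → (X v → Y v) × (Y v → X v)
infix 4 _≐_

{-# OPTIONS --safe #-}
-- If X is a strong 4-core of G₁ and Z a strong 4-core of G₂ containing A, then (X ∖ B) ∪ Z is a
-- strong 4-core of G₂: every vertex of its closed neighbourhood is either accounted for by Z, or
-- lies outside A ∪ B, where G₁ and G₂ have the same edges and no neighbour is in B.  Hence
-- S(G₁) ∖ B ⊆ S(G₂), and equality holds by symmetry; P and R follow.  A walk in G₁ − S(G₁)
-- starting outside B never enters A ∪ B, so it is also a walk in G₂ − S(G₂).
module Submission where

open import Defs
open import Data.Nat using (ℕ; _≤_)
open import Data.Nat.Properties using (≤-trans)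
open import Data.Bool using () renaming (_≟_ to _≟ᴮ_)
open import Data.Fin using (Fin)
open import Data.Fin.Subset using (Subset; _∈_; _∉_; _⊆_; _∩_; _∪_; ∁; ∣_∣) renaming (⊥ to ∅)
open import Data.Fin.Subset.Properties
  using (_∈?_; ∉⊥; p⊆q⇒∣p∣≤∣q∣; p⊆p∪q; q⊆p∪q; x∈p∪q⁻; x∈p∩q⁺; x∈p∩q⁻; x∉p⇒x∈∁p; x∈∁p⇒x∉p)
open import Data.Vec.Properties using ([]=⇒lookup; lookup⇒[]=; lookup∘tabulate)
open import Data.List using (List; []; _∷_; allFin)
open import Data.List.Membership.Propositional using () renaming (_∈_ to _∈ᴸ_)
open import Data.List.Membership.Propositional.Properties using (∈-allFin)
import Data.List.Relation.Unary.Any as Any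
open import Data.Product using (_×_; _,_; proj₁; proj₂; ∃-syntax)
open import Data.Sum using (_⊎_; inj₁; inj₂; [_,_]′) renaming (map to ⊎-map; swap to ⊎-swap)
open import Data.Empty using (⊥-elim)
open import Function using (_∘_)
open import Relation.Nullary using (¬_; yes; no)
open import Relation.Nullary.Decidable using (decidable-stable)
open import Relation.Binary.PropositionalEquality using (_≡_; refl; trans)
import Relation.Binary.PropositionalEquality as ≡

private
  variable
    n k : ℕ
    G G₁ G₂ : Graph n
    A B X Z : Subset n
    p q : Subset n
    v w x y t : Fin n

Edge-sym : (G : Graph n) → Edge G x y → Edge G y x
Edge-sym G e = trans (sym G _ _) e

∈-Nbhd⁺ : (G : Graph n) → Edge G x t → t ∈ Nbhd G x
∈-Nbhd⁺ {x = x} {t = t} G e = lookup⇒[]= t _ (trans (lookup∘tabulate (adj G x) t) e)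

∈-Nbhd⁻ : (G : Graph n) → t ∈ Nbhd G x → Edge G x t
∈-Nbhd⁻ {t = t} {x = x} G t∈N = trans (≡.sym (lookup∘tabulate (adj G x) t)) ([]=⇒lookup t∈N)

∩-monoʳ : (p : Subset n) → X ⊆ Z → p ∩ X ⊆ p ∩ Z
∩-monoʳ {X = X} p X⊆Z x∈p∩X with x∈p∩q⁻ p X x∈p∩X
... | x∈p , x∈X = x∈p∩q⁺ (x∈p , X⊆Z x∈X)

k≤∣p∣⇒k≤∣q∣ : p ⊆ q → k ≤ ∣ p ∣ → k ≤ ∣ q ∣
k≤∣p∣⇒k≤∣q∣ p⊆q k≤∣p∣ = ≤-trans k≤∣p∣ (p⊆q⇒∣p∣≤∣q∣ p⊆q)

degree-mono : (G : Graph n) (x : Fin n) → X ⊆ Z → 4 ≤ ∣ Nbhd G x ∩ X ∣ → 4 ≤ ∣ Nbhd G x ∩ Z ∣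
degree-mono G x X⊆Z = k≤∣p∣⇒k≤∣q∣ (∩-monoʳ (Nbhd G x) X⊆Z)

InClosedNbhd : Graph n → Subset n → Fin n → Set
InClosedNbhd G X x = x ∈ X ⊎ InNbhdOf G (_∈ X) x

∅-core : Strong4Core G ∅
∅-core x (inj₁ x∈∅)               = ⊥-elim (∉⊥ x∈∅)
∅-core x (inj₂ (_ , _ , t∈∅ , _)) = ⊥-elim (∉⊥ t∈∅)

InClosedNbhd-∪⁻ : InClosedNbhd G (X ∪ Z) x → InClosedNbhd G X x ⊎ InClosedNbhd G Z x
InClosedNbhd-∪⁻ {X = X} {Z} (inj₁ x∈X∪Z) = ⊎-map inj₁ inj₁ (x∈p∪q⁻ X Z x∈X∪Z)
InClosedNbhd-∪⁻ {X = X} {Z} (inj₂ (x∉X∪Z , t , t∈X∪Z , e)) with x∈p∪q⁻ X Z t∈X∪Z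
... | inj₁ t∈X = inj₁ (inj₂ (x∉X∪Z ∘ p⊆p∪q Z , t , t∈X , e))
... | inj₂ t∈Z = inj₂ (inj₂ (x∉X∪Z ∘ q⊆p∪q X Z , t , t∈Z , e))

∪-core : Strong4Core G X → Strong4Core G Z → Strong4Core G (X ∪ Z)
∪-core {G = G} {X = X} {Z} X-core Z-core x x∈N[X∪Z] =
  [ degree-mono G x (p⊆p∪q Z) ∘ X-core x
  , degree-mono G x (q⊆p∪q X Z) ∘ Z-core x
  ]′ (InClosedNbhd-∪⁻ {G = G} x∈N[X∪Z])

core-covering : (G : Graph n) → (∀ {v} → v ∈ A → InS G v) → (L : List (Fin n)) →
                ∃[ Z ] (Strong4Core G Z × (∀ {v} → v ∈ᴸ L → v ∈ A → v ∈ Z))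
core-covering G A⊆S [] = ∅ , ∅-core {G = G} , λ ()
core-covering {A = A} G A⊆S (u ∷ L) with core-covering G A⊆S L | u ∈? A
... | Z , Z-core , L∩A⊆Z | no u∉A =
  Z , Z-core , λ { (Any.here refl) u∈A → ⊥-elim (u∉A u∈A) ; (Any.there v∈L) → L∩A⊆Z v∈L }
... | Z , Z-core , L∩A⊆Z | yes u∈A with A⊆S u∈A
...   | W , W-core , u∈W =
  W ∪ Z , ∪-core {G = G} W-core Z-core ,
  λ { (Any.here refl) _ → p⊆p∪q Z u∈W ; (Any.there v∈L) → q⊆p∪q W Z ∘ L∩A⊆Z v∈L }

core-⊇ : (G : Graph n) → (∀ {v} → v ∈ A → InS G v) → ∃[ Z ] (Strong4Core G Z × A ⊆ Z)
core-⊇ G A⊆S with core-covering G A⊆S (allFin _)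
... | Z , Z-core , A⊆Z = Z , Z-core , A⊆Z (∈-allFin _)

record Perturbation (G₁ G₂ : Graph n) (A B : Subset n) : Set where
  field
    A⊆S   : ∀ v → v ∈ A → InS G₁ v × InS G₂ v
    NB⊆A  : ∀ v → InNbhdOf G₁ (_∈ B) v ⊎ InNbhdOf G₂ (_∈ B) v → v ∈ A
    Δ⊆A∪B : ∀ u v → ¬ (adj G₁ u v ≡ adj G₂ u v) → (u ∈ A ⊎ u ∈ B) × (v ∈ A ⊎ v ∈ B)

flip : Perturbation G₁ G₂ A B → Perturbation G₂ G₁ A B
flip π = record
  { A⊆S   = λ v v∈A → let (s₁ , s₂) = A⊆S v v∈A in s₂ , s₁
  ; NB⊆A  = λ v → NB⊆A v ∘ ⊎-swap
  ; Δ⊆A∪B = λ u v ≢ → Δ⊆A∪B u v (≢ ∘ ≡.sym)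
  }
  where open Perturbation π

module _ {G₁ G₂ : Graph n} {A B : Subset n} (π : Perturbation G₁ G₂ A B) where
  open Perturbation π

  ∉S⇒∉A : ¬ InS G₁ v → v ∉ A
  ∉S⇒∉A v∉S v∈A = v∉S (proj₁ (A⊆S _ v∈A))

  adj-agree : y ∉ A → y ∉ B → ∀ t → adj G₁ y t ≡ adj G₂ y t
  adj-agree {y} y∉A y∉B t =
    decidable-stable (adj G₁ y t ≟ᴮ adj G₂ y t) ([ y∉A , y∉B ]′ ∘ proj₁ ∘ Δ⊆A∪B y t)

  Edge-transfer : y ∉ A → y ∉ B → Edge G₁ y t → Edge G₂ y t
  Edge-transfer y∉A y∉B = trans (≡.sym (adj-agree y∉A y∉B _))

  Edge-∉B : y ∉ A → y ∉ B → Edge G₁ y t → t ∉ B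
  Edge-∉B y∉A y∉B e t∈B = y∉A (NB⊆A _ (inj₁ (y∉B , _ , t∈B , Edge-sym G₁ e)))

module _ {G₁ G₂ : Graph n} {A B : Subset n} (π : Perturbation G₁ G₂ A B) where
  open Perturbation π

  InClosedNbhd-transfer : A ⊆ Z → InClosedNbhd G₂ ((X ∩ ∁ B) ∪ Z) y →
                          InClosedNbhd G₂ Z y ⊎ (y ∉ A × y ∉ B × InClosedNbhd G₁ X y)
  InClosedNbhd-transfer {Z = Z} {y = y} A⊆Z y∈N[X∖B∪Z] with y ∈? Z
  ... | yes y∈Z = inj₁ (inj₁ y∈Z)
  InClosedNbhd-transfer {Z = Z} {X} A⊆Z (inj₁ y∈X∖B∪Z) | no y∉Z with x∈p∪q⁻ (X ∩ ∁ B) Z y∈X∖B∪Z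
  ... | inj₁ y∈X∖B = let (y∈X , y∈∁B) = x∈p∩q⁻ X (∁ B) y∈X∖B in
                     inj₂ (y∉Z ∘ A⊆Z , x∈∁p⇒x∉p y∈∁B , inj₁ y∈X)
  ... | inj₂ y∈Z   = ⊥-elim (y∉Z y∈Z)
  InClosedNbhd-transfer {Z = Z} {X} {y} A⊆Z (inj₂ (y∉X∖B∪Z , x , x∈X∖B∪Z , e)) | no y∉Z
    with x∈p∪q⁻ (X ∩ ∁ B) Z x∈X∖B∪Z
  ... | inj₂ x∈Z = inj₁ (inj₂ (y∉Z , x , x∈Z , e))
  ... | inj₁ x∈X∖B with x∈p∩q⁻ X (∁ B) x∈X∖B | y ∈? B
  ...   | x∈X , x∈∁B | yes y∈B =
    inj₁ (inj₂ (y∉Z , x , A⊆Z (NB⊆A x (inj₂ (x∈∁p⇒x∉p x∈∁B , y , y∈B , Edge-sym G₂ e))) , e))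
  ...   | x∈X , _    | no y∉B =
    inj₂ (y∉A , y∉B , inj₂ (y∉X , x , x∈X , Edge-sym G₁ (Edge-transfer (flip π) y∉A y∉B (Edge-sym G₂ e))))
    where
      y∉A : y ∉ A
      y∉A = y∉Z ∘ A⊆Z
      y∉X : y ∉ X
      y∉X y∈X = y∉X∖B∪Z (p⊆p∪q Z (x∈p∩q⁺ (y∈X , x∉p⇒x∈∁p y∉B)))

  -- As y ∉ A, no G₁-neighbour of y lies in B, so its neighbours in X stay in X ∖ B.
  degree-transfer : y ∉ A → y ∉ B → 4 ≤ ∣ Nbhd G₁ y ∩ X ∣ → 4 ≤ ∣ Nbhd G₂ y ∩ ((X ∩ ∁ B) ∪ Z) ∣
  degree-transfer {y} {X} {Z} y∉A y∉B = k≤∣p∣⇒k≤∣q∣ λ t∈N₁∩X →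
    let (t∈N₁ , t∈X) = x∈p∩q⁻ (Nbhd G₁ y) X t∈N₁∩X
        e = ∈-Nbhd⁻ G₁ t∈N₁
    in x∈p∩q⁺ (∈-Nbhd⁺ G₂ (Edge-transfer π y∉A y∉B e) ,
               p⊆p∪q Z (x∈p∩q⁺ (t∈X , x∉p⇒x∈∁p (Edge-∉B π y∉A y∉B e))))

  core-transfer : Strong4Core G₂ Z → A ⊆ Z → Strong4Core G₁ X → Strong4Core G₂ ((X ∩ ∁ B) ∪ Z)
  core-transfer {Z} {X} Z-core A⊆Z X-core y y∈N[X∖B∪Z] =
    [ degree-mono G₂ y (q⊆p∪q (X ∩ ∁ B) Z) ∘ Z-core y
    , (λ (y∉A , y∉B , y∈N[X]) → degree-transfer y∉A y∉B (X-core y y∈N[X]))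
    ]′ (InClosedNbhd-transfer A⊆Z y∈N[X∖B∪Z])

  S-transfer : v ∉ B → InS G₁ v → InS G₂ v
  S-transfer v∉B (X , X-core , v∈X) with core-⊇ G₂ (λ {v} v∈A → proj₂ (A⊆S v v∈A))
  ... | Z , Z-core , A⊆Z =
    (X ∩ ∁ B) ∪ Z , core-transfer Z-core A⊆Z X-core , p⊆p∪q Z (x∈p∩q⁺ (v∈X , x∉p⇒x∈∁p v∉B))

module _ {G₁ G₂ : Graph n} {A B : Subset n} (π : Perturbation G₁ G₂ A B) where

  ∉S-transfer : v ∉ B → ¬ InS G₁ v → ¬ InS G₂ v
  ∉S-transfer v∉B v∉S₁ = v∉S₁ ∘ S-transfer (flip π) v∉B

  P-transfer : v ∉ B → InP G₁ v → InP G₂ v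
  P-transfer v∉B (v∉S₁ , s , s∈S₁ , e) =
    ∉S-transfer v∉B v∉S₁ , s , S-transfer π (Edge-∉B π v∉A v∉B (Edge-sym G₁ e)) s∈S₁ ,
    Edge-sym G₂ (Edge-transfer π v∉A v∉B (Edge-sym G₁ e))
    where v∉A = ∉S⇒∉A π v∉S₁

  walk-avoids-A∪B : w ∉ B → WalkOutsideS G₁ w v → v ∉ A × v ∉ B
  walk-avoids-A∪B w∉B (here w∉S)        = ∉S⇒∉A π w∉S , w∉B
  walk-avoids-A∪B w∉B (step w∉S e walk) = walk-avoids-A∪B (Edge-∉B π (∉S⇒∉A π w∉S) w∉B e) walk

  walk-transfer : w ∉ B → WalkOutsideS G₁ w v → WalkOutsideS G₂ w v
  walk-transfer w∉B (here w∉S)        = here (∉S-transfer w∉B w∉S)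
  walk-transfer w∉B (step w∉S e walk) =
    step (∉S-transfer w∉B w∉S) (Edge-transfer π w∉A w∉B e) (walk-transfer (Edge-∉B π w∉A w∉B e) walk)
    where w∉A = ∉S⇒∉A π w∉S

module _ {G₁ G₂ : Graph n} {A B : Subset n} (π : Perturbation G₁ G₂ A B) where

  R-transfer : v ∉ B → InR G₁ v → InR G₂ v
  R-transfer v∉B (v∉S₁ , v∉P₁) = ∉S-transfer π v∉B v∉S₁ , v∉P₁ ∘ P-transfer (flip π) v∉B

  R∩C-transfer : w ∉ B → InR G₁ v × InC G₁ w v → InR G₂ v × InC G₂ w v
  R∩C-transfer w∉B (v∈R , v∈C) =
    R-transfer (proj₂ (walk-avoids-A∪B π w∉B v∈C)) v∈R , walk-transfer π w∉B v∈C

≐-outside : {P Q : Fin n → Set} (B : Subset n) →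
            (∀ {v} → v ∉ B → P v → Q v) → (∀ {v} → v ∉ B → Q v → P v) →
            (λ v → P v × v ∉ B) ≐ (λ v → Q v × v ∉ B)
≐-outside B P⇒Q Q⇒P v = (λ (p , v∉B) → P⇒Q v∉B p , v∉B) , (λ (q , v∉B) → Q⇒P v∉B q , v∉B)

lemma4p5 : ∀ {n : ℕ} (G₁ G₂ : Graph n) (A B : Subset n) →
    (∀ v → v ∈ A → InS G₁ v × InS G₂ v) →
    (∀ v → InNbhdOf G₁ (_∈ B) v ⊎ InNbhdOf G₂ (_∈ B) v → v ∈ A) →
    (∀ u v → ¬ (adj G₁ u v ≡ adj G₂ u v) → (u ∈ A ⊎ u ∈ B) × (v ∈ A ⊎ v ∈ B)) →
    ((λ v → InS G₁ v × v ∉ B) ≐ (λ v → InS G₂ v × v ∉ B))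
    × ((λ v → InP G₁ v × v ∉ B) ≐ (λ v → InP G₂ v × v ∉ B))
    × ((λ v → InR G₁ v × v ∉ B) ≐ (λ v → InR G₂ v × v ∉ B))
    × (∀ w → w ∉ B →
        (InC G₁ w ≐ InC G₂ w)
        × (∀ v → InC G₁ w v → v ∉ A × v ∉ B)
        × (∀ u v → InC G₁ w u → InC G₁ w v → adj G₁ u v ≡ adj G₂ u v)
        × ((λ v → InR G₁ v × InC G₁ w v) ≐ (λ v → InR G₂ v × InC G₂ w v)))
lemma4p5 G₁ G₂ A B A⊆S NB⊆A Δ⊆A∪B =
  ≐-outside B (S-transfer π) (S-transfer π⁻¹) ,
  ≐-outside B (P-transfer π) (P-transfer π⁻¹) ,
  ≐-outside B (R-transfer π) (R-transfer π⁻¹) ,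
  λ w w∉B →
    (λ v → walk-transfer π w∉B , walk-transfer π⁻¹ w∉B) ,
    (λ v → walk-avoids-A∪B π w∉B) ,
    (λ u v u∈C _ → let (u∉A , u∉B) = walk-avoids-A∪B π w∉B u∈C in adj-agree π u∉A u∉B v) ,
    (λ v → R∩C-transfer π w∉B , R∩C-transfer π⁻¹ w∉B)
  where
    π : Perturbation G₁ G₂ A B
    π = record { A⊆S = A⊆S ; NB⊆A = NB⊆A ; Δ⊆A∪B = Δ⊆A∪B }
    π⁻¹ : Perturbation G₂ G₁ A B
    π⁻¹ = flip π
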